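{- Let $(G=(V_G,E_G),k)$ be an instance of Max Vertex Cover with maximum degree $\Gamma$, and let $(\mathcal{T},(X,E),k')$ be the OptPDVC instance constructed from it as in the context. Then there exists a set of $k$ vertices of $G$ covering at least $W$ edges if and only if there exists a viable set $A\subseteq X$ of size $k'$ with $\mathrm{PD}(A)\geq W+k\cdot\Gamma$.
   Context: Max Vertex Cover: given a graph $G=(V_G,E_G)$ and a positive integer $k$, find $S\subseteq V_G$ with $|S|=k$ maximizing the number of edges incident to at least one vertex of $S$. Phylogenetic diversity: for a rooted tree $\mathcal{T}$ with root $r$, leaf set $X$ and non-negative edge weights, $\mathrm{PD}(S)$ for $S\subseteq X$ is the total weight of the edges of the minimal subtree spanning $S\cup\{r\}$. A food web is a DAG on $X$; $S\subseteq X$ is viable if every $s\in S$ is a sink or has an out-neighbour in $S$. Construction: for each vertex $v$ fix an ordering of its incident edges. Species $X=\{v_i,v'_i : v\in V_G,\ 1\leq i\leq\Gamma\}$. Food web edges $E=\{(v_i,v'_\Gamma): v\in V_G,\ 1\leq i\leq\Gamma\}\cup\{(v'_i,v'_{i-1}) : v\in V_G,\ 2\leq i\leq\Gamma\}$. The tree $\mathcal{T}$ has node set $\{r\}\cup E_G\cup X$ (one inner node per edge $f\in E_G$) and edges: $(r,f)$ for each $f\in E_G$ (weight $1$); $(r,v'_i)$ for all $v,i$ (weight $0$); $(f,v_i)$ whenever $f$ is the $i$-th incident edge of $v$ (weight $1$); $(r,v_i)$ whenever $v$ has degree smaller than $i$ (weight $1$). Budget $k'=2k\cdot\Gamma$.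 -}

module Defs where

open import Data.Nat using (ℕ; zero; suc; _+_; _*_; _≤_; _<_; _<?_)
open import Data.Nat.Properties using () renaming (_≟_ to _≟ℕ_)
open import Data.Fin using (Fin; toℕ; fromℕ<) renaming (_≟_ to _≟F_)
open import Data.Bool using (Bool; true; false; if_then_else_)
open import Data.List using (List; []; _∷_; length; filter; map; allFin; concatMap; _++_; any)
open import Data.List.Relation.Unary.Any using (Any)
open import Data.List.Membership.Propositional using (_∈_)
open import Data.Maybe using (Maybe; just; nothing)
open import Data.Product using (_×_; _,_; proj₁; proj₂; Σ; ∃)
open import Data.Sum using (_⊎_)
open import Relation.Nullary using (¬_; Dec; yes; no; does)
open import Relation.Nullary.Decidable using (_⊎-dec_)
open import Relation.Binary.PropositionalEquality using (_≡_; _≢_; refl; cong)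
open import Relation.Binary.Definitions using (DecidableEquality)
open import Function.Definitions using (Injective)
import Data.List.Membership.DecPropositional as DecMem
import Data.List.Relation.Unary.Any
open import Data.Nat.ListAction using (sum)

record Graph (n m : ℕ) : Set where
  field
    ends     : Fin m → Fin n × Fin n
    loopless : ∀ e → proj₁ (ends e) ≢ proj₂ (ends e)
    simple   : ∀ e e' →
               ((proj₁ (ends e) ≡ proj₁ (ends e') × proj₂ (ends e) ≡ proj₂ (ends e'))
                ⊎ (proj₁ (ends e) ≡ proj₂ (ends e') × proj₂ (ends e) ≡ proj₁ (ends e')))
               → e ≡ e'

module _ {n m : ℕ} (G : Graph n m) where
  open Graph G

  Incident : Fin m → Fin n → Set
  Incident e v = (proj₁ (ends e) ≡ v) ⊎ (proj₂ (ends e) ≡ v)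

  incident? : ∀ e v → Dec (Incident e v)
  incident? e v = (proj₁ (ends e) ≟F v) ⊎-dec (proj₂ (ends e) ≟F v)

  degree : Fin n → ℕ
  degree v = length (filter (λ e → incident? e v) (allFin m))

  -- Γ is the maximum degree of G (Γ = 0 for the empty vertex set)
  IsMaxDegree : ℕ → Set
  IsMaxDegree Γ = (∀ v → degree v ≤ Γ) × ((Γ ≡ 0) ⊎ ∃ λ v → degree v ≡ Γ)

  covers? : (S : List (Fin n)) → (e : Fin m) → Dec (Any (Incident e) S)
  covers? S e = Data.List.Relation.Unary.Any.any? (incident? e) S

  coveredEdges : List (Fin n) → ℕ
  coveredEdges S = length (filter (covers? S) (allFin m))

  -- for each vertex v, a fixed ordering of its incident edges:
  -- ord v i is the (i+1)-th incident edge of v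
  record IncidenceOrdering : Set where
    field
      ord       : (v : Fin n) → Fin (degree v) → Fin m
      ord-inc   : ∀ v i → Incident (ord v i) v
      ord-inj   : ∀ v → Injective _≡_ _≡_ (ord v)
      ord-surj  : ∀ v e → Incident e v → ∃ λ i → ord v i ≡ e

-- duplicate-free lists represent finite sets
open import Data.List.Relation.Unary.Unique.Propositional public using (Unique)

Sink : {X : Set} → (X → X → Set) → X → Set
Sink E s = ∀ t → ¬ E s t

Viable : {X : Set} → (X → X → Set) → List X → Set
Viable E S = ∀ s → s ∈ S → Sink E s ⊎ (∃ λ t → t ∈ S × E s t)

-- Rooted trees with non-negative (ℕ) edge weights, given by a parent
-- function: parent c = just (p , w) means there is an edge p → c of weight w;
-- the root (and only the root) has no parent.
record RootedTree : Set₁ where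
  field
    Node   : Set
    _≟N_   : DecidableEquality Node
    root   : Node
    nodes  : List Node
    parent : Node → Maybe (Node × ℕ)

module _ (T : RootedTree) where
  open RootedTree T

  ancestorsFuel : ℕ → Node → List Node
  ancestorsFuel zero    x = x ∷ []
  ancestorsFuel (suc k) x with parent x
  ... | nothing      = x ∷ []
  ... | just (p , _) = x ∷ ancestorsFuel k p

  ancestors : Node → List Node
  ancestors x = ancestorsFuel (length nodes) x

  open DecMem _≟N_ using (_∈?_)

  -- the edge into c lies in the minimal subtree spanning S ∪ {root}
  -- iff some node of S is a descendant of c (or c itself)
  spans? : (S : List Node) → (c : Node) → Dec (Any (λ s → c ∈ ancestors s) S)
  spans? S c = Data.List.Relation.Unary.Any.any? (λ s → c ∈? ancestors s) S

  edgeContribution : List Node → Node → ℕ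
  edgeContribution S c with parent c
  ... | nothing      = 0
  ... | just (_ , w) = if does (spans? S c) then w else 0

  -- phylogenetic diversity: total weight of the minimal subtree spanning S ∪ {root}
  PD : List Node → ℕ
  PD S = sum (map (edgeContribution S) nodes)

-- species v_i (plain v i) and v'_i (primed v i); index i : Fin Γ stands
-- for the paper's index toℕ i + 1 ∈ {1,…,Γ}
data Species (n Γ : ℕ) : Set where
  plain  : Fin n → Fin Γ → Species n Γ
  primed : Fin n → Fin Γ → Species n Γ

_≟S_ : ∀ {n Γ} → DecidableEquality (Species n Γ)
plain v i ≟S plain w j with v ≟F w | i ≟F j
... | yes refl | yes refl = yes refl
... | no p     | _        = no λ { refl → p refl }
... | yes _    | no q     = no λ { refl → q refl }
primed v i ≟S primed w j with v ≟F w | i ≟F j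
... | yes refl | yes refl = yes refl
... | no p     | _        = no λ { refl → p refl }
... | yes _    | no q     = no λ { refl → q refl }
plain _ _ ≟S primed _ _ = no λ ()
primed _ _ ≟S plain _ _ = no λ ()

allSpecies : (n Γ : ℕ) → List (Species n Γ)
allSpecies n Γ =
  concatMap (λ v → concatMap (λ i → plain v i ∷ primed v i ∷ []) (allFin Γ)) (allFin n)

-- food web edges: (v_i , v'_Γ) and (v'_i , v'_{i-1}) for 2 ≤ i ≤ Γ
data FoodWeb {n Γ : ℕ} : Species n Γ → Species n Γ → Set where
  toTop  : ∀ v i j → suc (toℕ j) ≡ Γ → FoodWeb (plain v i) (primed v j)
  down   : ∀ v i j → toℕ i ≡ suc (toℕ j) → FoodWeb (primed v i) (primed v j)

data TNode (n m Γ : ℕ) : Set where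
  root  : TNode n m Γ
  inner : Fin m → TNode n m Γ
  leaf  : Species n Γ → TNode n m Γ

_≟T_ : ∀ {n m Γ} → DecidableEquality (TNode n m Γ)
root ≟T root = yes refl
inner f ≟T inner g with f ≟F g
... | yes refl = yes refl
... | no p     = no λ { refl → p refl }
leaf s ≟T leaf t with s ≟S t
... | yes refl = yes refl
... | no p     = no λ { refl → p refl }
root ≟T inner _ = no λ ()
root ≟T leaf _ = no λ ()
inner _ ≟T root = no λ ()
inner _ ≟T leaf _ = no λ ()
leaf _ ≟T root = no λ ()
leaf _ ≟T inner _ = no λ ()

module _ {n m : ℕ} (G : Graph n m) (Γ : ℕ) (O : IncidenceOrdering G) where
  open IncidenceOrdering O

  -- tree edges: (r,f) weight 1; (r,v'_i) weight 0;
  -- (f,v_i) weight 1 if f is the i-th incident edge of v (i ≤ deg v);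
  -- (r,v_i) weight 1 if deg v < i
  treeParent : TNode n m Γ → Maybe (TNode n m Γ × ℕ)
  treeParent root                = nothing
  treeParent (inner f)           = just (root , 1)
  treeParent (leaf (primed v i)) = just (root , 0)
  treeParent (leaf (plain v i)) with toℕ i <? degree G v
  ... | yes p = just (inner (ord v (fromℕ< p)) , 1)
  ... | no _  = just (root , 1)

  constructedTree : RootedTree
  constructedTree = record
    { Node   = TNode n m Γ
    ; _≟N_   = _≟T_
    ; root   = root
    ; nodes  = root ∷ map inner (allFin m) ++ map leaf (allSpecies n Γ)
    ; parent = treeParent
    }

  PDC : List (Species n Γ) → ℕ
  PDC A = PD constructedTree (map leaf A)

module Submission where

-- Write P(A), Q(A) for the numbers of plain species v_i and primed species
-- v'_i in A.  The weight-1 edges of the tree are the edges (r,f), f ∈ E_G,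
-- and the pendant edges of plain species, so
--     PD(A) = #{f : some species of A hangs below f} + P(A).
-- (⇒) For S with |S| = k take all 2Γ species of the vertices of S: this is
--     viable, hangs below every edge covered by S, and P = kΓ.
-- (⇐) Viability forces every v_i ∈ A to bring along all of v'_1, …, v'_Γ.
--     Call such vertices saturated, t of them.  Then P(A) ≤ tΓ ≤ Q(A),
--     P(A) + Q(A) ≤ 2kΓ, and the saturated vertices cover every edge below
--     which A hangs.  Keeping k vertices, saturated first, loses at most
--     (t - k)Γ edges, and the counting inequalities give (t - k)Γ + P ≤ kΓ.

open import Defs
open import Data.Nat
open import Data.Nat.Properties
open import Data.Nat.ListAction using (sum)
open import Data.Nat.ListAction.Properties using (sum-++)
open import Algebra.Properties.CommutativeSemigroup +-commutativeSemigroup using (interchange)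
open import Data.Bool using (true; false; if_then_else_)
open import Data.Fin using (Fin; toℕ; fromℕ; fromℕ<; inject₁; inject≤)
open import Data.Fin.Properties using (toℕ-injective; toℕ<n; toℕ-fromℕ; toℕ-inject₁; toℕ-inject≤; toℕ-fromℕ<; all?)
import Data.Fin
open import Data.List using (List; []; _∷_; _++_; map; length; filter; concatMap; take; drop; allFin)
open import Data.List.Properties using (map-++; map-cong; map-∘; length-++; length-take; length-drop; length-tabulate; filter-none)
open import Data.List.Relation.Unary.Any using (Any; here; there)
open import Data.List.Relation.Unary.AllPairs using ([]; _∷_)
import Data.List.Relation.Unary.All as All
open import Data.List.Relation.Unary.All using ([]; _∷_)
open import Data.List.Membership.Propositional using (_∈_; find; lose)
open import Data.List.Membership.Propositional.Properties using (∈-concatMap⁻; ∈-concatMap⁺; ∈-allFin; ∈-filter⁺; ∈-filter⁻)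
import Data.List.Membership.DecPropositional as DecMembership
open import Data.List.Relation.Binary.Subset.Propositional using (_⊆_)
import Data.List.Relation.Unary.Unique.Propositional.Properties as Unique
open import Data.Product using (_×_; _,_; ∃; proj₁; proj₂)
open import Data.Sum using (_⊎_; inj₁; inj₂)
open import Data.Empty using (⊥-elim)
open import Data.Maybe using (just; nothing)
open import Relation.Nullary using (Dec; yes; no; does; ¬_; ¬?)
open import Relation.Unary using (Decidable)
open import Relation.Binary.PropositionalEquality
open import Function.Bundles using (_⇔_; mk⇔; Equivalence)
import Data.List.Relation.Unary.Any as Any
import Data.List.Relation.Unary.Any.Properties as Any

χ : {P : Set} → Dec P → ℕ
χ d = if does d then 1 else 0

χ-yes : {P : Set} (d : Dec P) → P → χ d ≡ 1
χ-yes (yes _) _ = refl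
χ-yes (no ¬p) p = ⊥-elim (¬p p)

χ-no : {P : Set} (d : Dec P) → ¬ P → χ d ≡ 0
χ-no (yes p) ¬p = ⊥-elim (¬p p)
χ-no (no _)  _  = refl

χ≤1 : {P : Set} (d : Dec P) → χ d ≤ 1
χ≤1 (yes _) = ≤-refl
χ≤1 (no _)  = z≤n

χ-mono : {P Q : Set} → (P → Q) → (d : Dec P) (e : Dec Q) → χ d ≤ χ e
χ-mono f (yes p) e = ≤-reflexive (sym (χ-yes e (f p)))
χ-mono f (no _)  e = z≤n

χ-cong : {P Q : Set} → (P → Q) → (Q → P) → (d : Dec P) (e : Dec Q) → χ d ≡ χ e
χ-cong f g d e = ≤-antisym (χ-mono f d e) (χ-mono g e d)

χ-split : {P Q R : Set} → (P → Q ⊎ R) → (d : Dec P) (e : Dec Q) (h : Dec R) →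
          χ d ≤ χ e + χ h
χ-split f (no _)  e h = z≤n
χ-split f (yes p) e h with f p
... | inj₁ q = ≤-trans (≤-reflexive (sym (χ-yes e q))) (m≤m+n (χ e) (χ h))
... | inj₂ r = ≤-trans (≤-reflexive (sym (χ-yes h r))) (m≤n+m (χ h) (χ e))

χ*-upper : {P : Set} (d : Dec P) {a c : ℕ} → (P → a ≤ c) → (¬ P → a ≡ 0) → a ≤ χ d * c
χ*-upper (yes p) {c = c} f g = ≤-trans (f p) (≤-reflexive (sym (+-identityʳ c)))
χ*-upper (no ¬p)         f g = ≤-reflexive (g ¬p)

χ*-lower : {P : Set} (d : Dec P) {a c : ℕ} → (P → c ≤ a) → χ d * c ≤ a
χ*-lower (yes p) {c = c} f = ≤-trans (≤-reflexive (+-identityʳ c)) (f p)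
χ*-lower (no _)          f = z≤n

-- If p ≤ a and p + a ≤ 2b, then (a ∸ b) + p ≤ b.  This is the final
-- counting step of the (⇐) direction, with a = tΓ, b = kΓ and p = P(A).
excess-bound : ∀ {a b p} → p ≤ a → p + a ≤ b + b → a ∸ b + p ≤ b
excess-bound {a} {b} {p} p≤a p+a≤2b with ≤-total a b
... | inj₁ a≤b = begin
  a ∸ b + p ≡⟨ cong (_+ p) (m≤n⇒m∸n≡0 a≤b) ⟩
  p         ≤⟨ ≤-trans p≤a a≤b ⟩
  b         ∎
  where open ≤-Reasoning
... | inj₂ b≤a = +-cancelʳ-≤ b _ _ (begin
  a ∸ b + p + b   ≡⟨ +-assoc (a ∸ b) p b ⟩
  a ∸ b + (p + b) ≡⟨ cong (a ∸ b +_) (+-comm p b) ⟩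
  a ∸ b + (b + p) ≡⟨ sym (+-assoc (a ∸ b) b p) ⟩
  a ∸ b + b + p   ≡⟨ cong (_+ p) (m∸n+n≡m b≤a) ⟩
  a + p           ≡⟨ +-comm a p ⟩
  p + a           ≤⟨ p+a≤2b ⟩
  b + b           ∎)
  where open ≤-Reasoning

module _ {A : Set} where

  ∑ : (A → ℕ) → List A → ℕ
  ∑ f xs = sum (map f xs)

  ∑-mono : {f g : A → ℕ} → (∀ x → f x ≤ g x) → ∀ xs → ∑ f xs ≤ ∑ g xs
  ∑-mono h []       = z≤n
  ∑-mono h (x ∷ xs) = +-mono-≤ (h x) (∑-mono h xs)

  ∑-cong : {f g : A → ℕ} → (∀ x → f x ≡ g x) → ∀ xs → ∑ f xs ≡ ∑ g xs
  ∑-cong h xs = cong sum (map-cong h xs)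

  ∑-zero : {f : A → ℕ} → (∀ x → f x ≡ 0) → ∀ xs → ∑ f xs ≡ 0
  ∑-zero f≡0 []       = refl
  ∑-zero f≡0 (x ∷ xs) = cong₂ _+_ (f≡0 x) (∑-zero f≡0 xs)

  ∑-+ : (f g : A → ℕ) → ∀ xs → ∑ (λ x → f x + g x) xs ≡ ∑ f xs + ∑ g xs
  ∑-+ f g []       = refl
  ∑-+ f g (x ∷ xs) = trans (cong (f x + g x +_) (∑-+ f g xs)) (interchange (f x) (g x) _ _)

  ∑-*ʳ : (f : A → ℕ) (c : ℕ) → ∀ xs → ∑ (λ x → f x * c) xs ≡ ∑ f xs * c
  ∑-*ʳ f c []       = refl
  ∑-*ʳ f c (x ∷ xs) = trans (cong (f x * c +_) (∑-*ʳ f c xs)) (sym (*-distribʳ-+ c (f x) (∑ f xs)))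

  ∑-const : (c : ℕ) → ∀ xs → ∑ (λ _ → c) xs ≡ length xs * c
  ∑-const c []       = refl
  ∑-const c (x ∷ xs) = cong (c +_) (∑-const c xs)

  ∑-++ : (f : A → ℕ) → ∀ xs ys → ∑ f (xs ++ ys) ≡ ∑ f xs + ∑ f ys
  ∑-++ f xs ys = trans (cong sum (map-++ f xs ys)) (sum-++ (map f xs) (map f ys))

  length-filter≡∑χ : {P : A → Set} (P? : Decidable P) → ∀ xs →
                     length (filter P? xs) ≡ ∑ (λ x → χ (P? x)) xs
  length-filter≡∑χ P? []       = refl
  length-filter≡∑χ P? (x ∷ xs) with P? x
  ... | yes _ = cong suc (length-filter≡∑χ P? xs)
  ... | no _  = length-filter≡∑χ P? xs

  ∈-take-or-drop : ∀ k (xs ys : List A) {v} → v ∈ xs → v ∈ take k (xs ++ ys) ⊎ v ∈ drop k xs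
  ∈-take-or-drop zero    xs       ys v∈         = inj₂ v∈
  ∈-take-or-drop (suc k) (x ∷ xs) ys (here e)   = inj₁ (here e)
  ∈-take-or-drop (suc k) (x ∷ xs) ys (there v∈) with ∈-take-or-drop k xs ys v∈
  ... | inj₁ p = inj₁ (there p)
  ... | inj₂ p = inj₂ p

  length-filter-partition : {P : A → Set} (P? : Decidable P) → ∀ xs →
    length (filter P? xs) + length (filter (λ x → ¬? (P? x)) xs) ≡ length xs
  length-filter-partition P? []       = refl
  length-filter-partition P? (x ∷ xs) with P? x
  ... | yes _ = cong suc (length-filter-partition P? xs)
  ... | no _  = trans (+-suc _ _) (cong suc (length-filter-partition P? xs))

  remove : ∀ {x : A} {ys} → x ∈ ys → List A
  remove {ys = _ ∷ ys} (here _)  = ys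
  remove {ys = y ∷ _}  (there p) = y ∷ remove p

  length-remove : ∀ {x : A} {ys} (p : x ∈ ys) → suc (length (remove p)) ≡ length ys
  length-remove (here _)  = refl
  length-remove (there p) = cong suc (length-remove p)

  ∈-remove : ∀ {x z : A} {ys} (p : x ∈ ys) → z ∈ ys → z ≢ x → z ∈ remove p
  ∈-remove (here refl) (here refl) z≢x = ⊥-elim (z≢x refl)
  ∈-remove (here refl) (there z∈)  _   = z∈
  ∈-remove (there p)   (here e)    _   = here e
  ∈-remove (there p)   (there z∈)  z≢x = there (∈-remove p z∈ z≢x)

  unique-⊆⇒length≤ : ∀ {xs ys : List A} → Unique xs → xs ⊆ ys → length xs ≤ length ys
  unique-⊆⇒length≤ {[]}     _             _  = z≤n
  unique-⊆⇒length≤ {x ∷ xs} (x∉xs ∷ u) xs⊆ys =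
    ≤-trans (s≤s (unique-⊆⇒length≤ u xs⊆rest)) (≤-reflexive (length-remove x∈ys))
    where
    x∈ys = xs⊆ys (here refl)
    xs⊆rest : xs ⊆ remove x∈ys
    xs⊆rest z∈ = ∈-remove x∈ys (xs⊆ys (there z∈)) (λ z≡x → All.lookup x∉xs z∈ (sym z≡x))

module _ {A B : Set} where

  ∑-map : (f : B → ℕ) (g : A → B) → ∀ xs → ∑ f (map g xs) ≡ ∑ (λ x → f (g x)) xs
  ∑-map f g xs = cong sum (sym (map-∘ xs))

  ∑-concatMap : (g : B → ℕ) (f : A → List B) → ∀ xs →
                ∑ g (concatMap f xs) ≡ ∑ (λ x → ∑ g (f x)) xs
  ∑-concatMap g f []       = refl
  ∑-concatMap g f (x ∷ xs) = trans (∑-++ g (f x) (concatMap f xs)) (cong (∑ g (f x) +_) (∑-concatMap g f xs))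

  length-concatMap : (f : A → List B) (c : ℕ) → (∀ x → length (f x) ≡ c) → ∀ xs →
                     length (concatMap f xs) ≡ length xs * c
  length-concatMap f c h []       = refl
  length-concatMap f c h (x ∷ xs) =
    trans (length-++ (f x)) (cong₂ _+_ (h x) (length-concatMap f c h xs))

  concatMap-unique : (f : A → List B) (key : B → A) → (∀ x {b} → b ∈ f x → key b ≡ x) →
                     (∀ x → Unique (f x)) → ∀ {xs} → Unique xs → Unique (concatMap f xs)
  concatMap-unique f key tagged uf {[]}     []           = []
  concatMap-unique f key tagged uf {x ∷ xs} (x∉xs ∷ uxs) =
    Unique.++⁺ (uf x) (concatMap-unique f key tagged uf uxs) disjoint
    where
    disjoint : ∀ {b} → ¬ (b ∈ f x × b ∈ concatMap f xs)
    disjoint (b∈fx , b∈rest) with find (∈-concatMap⁻ f b∈rest)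
    ... | y , y∈xs , b∈fy = All.lookup x∉xs y∈xs (trans (sym (tagged x b∈fx)) (tagged y b∈fy))

module Covering {n m : ℕ} (G : Graph n m) where

  covered≡∑χ : ∀ X → coveredEdges G X ≡ ∑ (λ e → χ (covers? G X e)) (allFin m)
  covered≡∑χ X = length-filter≡∑χ (covers? G X) (allFin m)

  covered-∪ : ∀ X Y Z → (∀ {v} → v ∈ X → v ∈ Y ⊎ v ∈ Z) →
              coveredEdges G X ≤ coveredEdges G Y + coveredEdges G Z
  covered-∪ X Y Z X⊆Y∪Z = begin
    coveredEdges G X                                   ≡⟨ covered≡∑χ X ⟩
    ∑ (λ e → χ (covers? G X e)) (allFin m)             ≤⟨ ∑-mono split (allFin m) ⟩
    ∑ (λ e → χ (covers? G Y e) + χ (covers? G Z e)) (allFin m)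
                                                       ≡⟨ ∑-+ _ _ (allFin m) ⟩
    ∑ (λ e → χ (covers? G Y e)) (allFin m) + ∑ (λ e → χ (covers? G Z e)) (allFin m)
                                                       ≡⟨ sym (cong₂ _+_ (covered≡∑χ Y) (covered≡∑χ Z)) ⟩
    coveredEdges G Y + coveredEdges G Z                ∎
    where
    open ≤-Reasoning
    coverer : ∀ {e} → Any (Incident G e) X → Any (Incident G e) Y ⊎ Any (Incident G e) Z
    coverer c with find c
    ... | v , v∈X , inc with X⊆Y∪Z v∈X
    ...   | inj₁ v∈Y = inj₁ (lose v∈Y inc)
    ...   | inj₂ v∈Z = inj₂ (lose v∈Z inc)
    split : ∀ e → χ (covers? G X e) ≤ χ (covers? G Y e) + χ (covers? G Z e)
    split e = χ-split coverer (covers? G X e) (covers? G Y e) (covers? G Z e)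

  covered-[] : coveredEdges G [] ≡ 0
  covered-[] = cong length (filter-none (covers? G []) (All.universal (λ _ ()) (allFin m)))

  covered-singleton : ∀ v → coveredEdges G (v ∷ []) ≤ degree G v
  covered-singleton v = begin
    coveredEdges G (v ∷ [])                          ≡⟨ covered≡∑χ (v ∷ []) ⟩
    ∑ (λ e → χ (covers? G (v ∷ []) e)) (allFin m)    ≤⟨ ∑-mono incident (allFin m) ⟩
    ∑ (λ e → χ (incident? G e v)) (allFin m)         ≡⟨ sym (length-filter≡∑χ (λ e → incident? G e v) (allFin m)) ⟩
    degree G v                                       ∎
    where
    open ≤-Reasoning
    incident : ∀ e → χ (covers? G (v ∷ []) e) ≤ χ (incident? G e v)
    incident e = χ-mono (λ { (here inc) → inc }) (covers? G (v ∷ []) e) (incident? G e v)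

  module BoundedDegree {Γ : ℕ} (maxdeg : ∀ v → degree G v ≤ Γ) where

    covered≤ : ∀ X → coveredEdges G X ≤ length X * Γ
    covered≤ []      = ≤-reflexive covered-[]
    covered≤ (x ∷ X) =
      ≤-trans (covered-∪ (x ∷ X) (x ∷ []) X (λ { (here e) → inj₁ (here e) ; (there p) → inj₂ p }))
              (+-mono-≤ (≤-trans (covered-singleton x) (maxdeg x)) (covered≤ X))

    covered-take : ∀ k xs ys →
      coveredEdges G xs ≤ coveredEdges G (take k (xs ++ ys)) + (length xs ∸ k) * Γ
    covered-take k xs ys =
      ≤-trans (covered-∪ xs _ _ (∈-take-or-drop k xs ys))
              (+-monoʳ-≤ (coveredEdges G (take k (xs ++ ys)))
                 (≤-trans (covered≤ (drop k xs)) (≤-reflexive (cong (_* Γ) (length-drop k xs)))))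

module Ancestry (T : RootedTree) where
  open RootedTree T

  ancestor-refl : ∀ k x → x ∈ ancestorsFuel T k x
  ancestor-refl zero    x = here refl
  ancestor-refl (suc k) x with parent x
  ... | nothing = here refl
  ... | just _  = here refl

  ancestor-parent : ∀ k {x p w} → parent x ≡ just (p , w) → p ∈ ancestorsFuel T (suc k) x
  ancestor-parent k {x} eq with parent x
  ancestor-parent k refl | just _ = there (ancestor-refl k _)

  ancestor-step : ∀ k {x p w y} → parent x ≡ just (p , w) →
                  y ∈ ancestorsFuel T (suc k) x → y ≡ x ⊎ y ∈ ancestorsFuel T k p
  ancestor-step k {x} eq y∈ with parent x
  ancestor-step k refl (here e)  | just _ = inj₁ e
  ancestor-step k refl (there q) | just _ = inj₂ q

  ancestor-orphan : ∀ k {x y} → parent x ≡ nothing → y ∈ ancestorsFuel T k x → y ≡ x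
  ancestor-orphan zero    eq (here e) = e
  ancestor-orphan (suc k) {x} eq y∈ with parent x
  ancestor-orphan (suc k) refl (here e) | nothing = e

top : ∀ {N} → Fin N → ∃ λ (j : Fin N) → suc (toℕ j) ≡ N
top {suc N} _ = fromℕ N , cong suc (toℕ-fromℕ N)

predecessor : ∀ {N} (i : Fin N) → toℕ i ≡ 0 ⊎ ∃ λ (j : Fin N) → toℕ i ≡ suc (toℕ j)
predecessor Data.Fin.zero        = inj₁ refl
predecessor {suc N} (Data.Fin.suc i) = inj₂ (inject₁ i , cong suc (sym (toℕ-inject₁ i)))

length-allFin : ∀ N → length (allFin N) ≡ N
length-allFin N = length-tabulate {n = N} (λ i → i)

∑-allFin-≤ : ∀ {N} {g : Fin N → ℕ} → (∀ i → g i ≤ 1) → ∑ g (allFin N) ≤ N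
∑-allFin-≤ {N} g≤1 = ≤-trans (∑-mono g≤1 (allFin N))
                      (≤-reflexive (trans (∑-const 1 (allFin N)) (trans (*-identityʳ _) (length-allFin N))))

∑-allFin-≥ : ∀ {N} {g : Fin N → ℕ} → (∀ i → 1 ≤ g i) → N ≤ ∑ g (allFin N)
∑-allFin-≥ {N} 1≤g = ≤-trans (≤-reflexive (sym (trans (∑-const 1 (allFin N)) (trans (*-identityʳ _) (length-allFin N)))))
                      (∑-mono 1≤g (allFin N))

∑-χ*ʳ : ∀ {N : ℕ} {P : Fin N → Set} (P? : Decidable P) (c : ℕ) →
        ∑ (λ v → χ (P? v) * c) (allFin N) ≡ length (filter P? (allFin N)) * c
∑-χ*ʳ {N} P? c = trans (∑-*ʳ (λ v → χ (P? v)) c (allFin N)) (cong (_* c) (sym (length-filter≡∑χ P? (allFin N))))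

module Construction {n m : ℕ} (G : Graph n m) (Γ : ℕ) (O : IncidenceOrdering G) where
  open IncidenceOrdering O
  open Covering G
  open DecMembership (_≟S_ {n} {Γ}) using () renaming (_∈?_ to _∈S?_)

  𝒯 : RootedTree
  𝒯 = constructedTree G Γ O
  open Ancestry 𝒯

  vertexOf : Species n Γ → Fin n
  vertexOf (plain v _)  = v
  vertexOf (primed v _) = v

  indexOf : Species n Γ → Fin Γ
  indexOf (plain _ i)  = i
  indexOf (primed _ i) = i

  pair : Fin n → Fin Γ → List (Species n Γ)
  pair v i = plain v i ∷ primed v i ∷ []

  block : Fin n → List (Species n Γ)
  block v = concatMap (pair v) (allFin Γ)

  speciesOf : List (Fin n) → List (Species n Γ)
  speciesOf = concatMap block

  ∈-pair⇒ : ∀ {v i s} → s ∈ pair v i → vertexOf s ≡ v × indexOf s ≡ i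
  ∈-pair⇒ (here refl)         = refl , refl
  ∈-pair⇒ (there (here refl)) = refl , refl

  ∈-block⇒ : ∀ {v s} → s ∈ block v → vertexOf s ≡ v
  ∈-block⇒ {v} s∈ with find (∈-concatMap⁻ (pair v) {xs = allFin Γ} s∈)
  ... | _ , _ , s∈pair = proj₁ (∈-pair⇒ s∈pair)

  ∈-block : ∀ s → s ∈ block (vertexOf s)
  ∈-block (plain v i)  = ∈-concatMap⁺ (pair v) (lose (∈-allFin i) (here refl))
  ∈-block (primed v i) = ∈-concatMap⁺ (pair v) (lose (∈-allFin i) (there (here refl)))

  ∈-speciesOf⁺ : ∀ S {s} → vertexOf s ∈ S → s ∈ speciesOf S
  ∈-speciesOf⁺ S {s} v∈S = ∈-concatMap⁺ block (lose v∈S (∈-block s))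

  ∈-speciesOf⁻ : ∀ S {s} → s ∈ speciesOf S → vertexOf s ∈ S
  ∈-speciesOf⁻ S s∈ with find (∈-concatMap⁻ block s∈)
  ... | v , v∈S , s∈block = subst (_∈ _) (sym (∈-block⇒ s∈block)) v∈S

  speciesOf-unique : ∀ {S} → Unique S → Unique (speciesOf S)
  speciesOf-unique = concatMap-unique block vertexOf (λ _ → ∈-block⇒) block-unique
    where
    block-unique : ∀ v → Unique (block v)
    block-unique v = concatMap-unique (pair v) indexOf (λ _ s∈ → proj₂ (∈-pair⇒ s∈))
                       (λ _ → ((λ ()) ∷ []) ∷ [] ∷ []) (Unique.allFin⁺ Γ)

  length-speciesOf : ∀ S → length (speciesOf S) ≡ length S * (2 * Γ)
  length-speciesOf = length-concatMap block (2 * Γ) λ v →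
    trans (length-concatMap (pair v) 2 (λ _ → refl) (allFin Γ))
          (trans (cong (_* 2) (length-allFin Γ)) (*-comm Γ 2))

  ∑-speciesOf : ∀ (g : Species n Γ → ℕ) S →
    ∑ g (speciesOf S) ≡ ∑ (λ v → ∑ (λ i → g (plain v i) + g (primed v i)) (allFin Γ)) S
  ∑-speciesOf g S = trans (∑-concatMap g block S) (∑-cong per-vertex S)
    where
    per-vertex : ∀ v → ∑ g (block v) ≡ ∑ (λ i → g (plain v i) + g (primed v i)) (allFin Γ)
    per-vertex v = trans (∑-concatMap g (pair v) (allFin Γ))
                         (∑-cong (λ i → cong (g (plain v i) +_) (+-identityʳ _)) (allFin Γ))

  plainCount : List (Species n Γ) → ℕ
  plainCount A = ∑ (λ v → ∑ (λ i → χ (plain v i ∈S? A)) (allFin Γ)) (allFin n)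

  primedCount : List (Species n Γ) → ℕ
  primedCount A = ∑ (λ v → ∑ (λ i → χ (primed v i ∈S? A)) (allFin Γ)) (allFin n)

  -- allSpecies lists every species once, so P(A) + Q(A) counts distinct elements of A.
  plain+primed≤length : ∀ A → plainCount A + primedCount A ≤ length A
  plain+primed≤length A = begin
    plainCount A + primedCount A
      ≡⟨ sym (∑-+ _ _ (allFin n)) ⟩
    ∑ (λ v → ∑ (λ i → χ (plain v i ∈S? A)) (allFin Γ) + ∑ (λ i → χ (primed v i ∈S? A)) (allFin Γ)) (allFin n)
      ≡⟨ ∑-cong (λ v → sym (∑-+ _ _ (allFin Γ))) (allFin n) ⟩
    ∑ (λ v → ∑ (λ i → χ (plain v i ∈S? A) + χ (primed v i ∈S? A)) (allFin Γ)) (allFin n)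
      ≡⟨ sym (∑-speciesOf (λ s → χ (s ∈S? A)) (allFin n)) ⟩
    ∑ (λ s → χ (s ∈S? A)) (allSpecies n Γ)
      ≡⟨ sym (length-filter≡∑χ (_∈S? A) (allSpecies n Γ)) ⟩
    length (filter (_∈S? A) (allSpecies n Γ))
      ≤⟨ unique-⊆⇒length≤ (Unique.filter⁺ (_∈S? A) (speciesOf-unique (Unique.allFin⁺ n)))
                          (λ s∈ → proj₂ (∈-filter⁻ (_∈S? A) {xs = allSpecies n Γ} s∈)) ⟩
    length A ∎
    where open ≤-Reasoning

  -- The plain species v_i with i ≤ deg v hangs below the inner node of the
  -- i-th incident edge of v; these are the only leaves below inner nodes.
  data HangsBelow : Species n Γ → Fin m → Set where
    hangs : ∀ v i (q : toℕ i < degree G v) → HangsBelow (plain v i) (ord v (fromℕ< q))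

  hangs⇒incident : ∀ {a f} → HangsBelow a f → Incident G f (vertexOf a)
  hangs⇒incident (hangs v i q) = ord-inc v (fromℕ< q)

  hangs⇒parent : ∀ {a f} → HangsBelow a f → treeParent G Γ O (leaf a) ≡ just (inner f , 1)
  hangs⇒parent (hangs v i q) with toℕ i <? degree G v
  ... | yes q′ = cong (λ q″ → just (inner (ord v (fromℕ< q″)) , 1)) (<-irrelevant q′ q)
  ... | no ¬q  = ⊥-elim (¬q q)

  leaf-parent : ∀ a → (∃ λ w → treeParent G Γ O (leaf a) ≡ just (root , w))
                    ⊎ (∃ λ f → HangsBelow a f × treeParent G Γ O (leaf a) ≡ just (inner f , 1))
  leaf-parent (primed v i) = inj₁ (0 , refl)
  leaf-parent (plain v i) with toℕ i <? degree G v
  ... | yes q = inj₂ (_ , hangs v i q , refl)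
  ... | no _  = inj₁ (1 , refl)

  inner-ancestors : ∀ k f {y} → y ∈ ancestorsFuel 𝒯 k (inner f) → y ≡ inner f ⊎ y ≡ root
  inner-ancestors zero    f (here e) = inj₁ e
  inner-ancestors (suc k) f y∈ with ancestor-step k refl y∈
  ... | inj₁ e   = inj₁ e
  ... | inj₂ y∈′ = inj₂ (ancestor-orphan k refl y∈′)

  -- `ancestors` walks up with fuel suc fuel, the number of nodes of the tree.
  fuel : ℕ
  fuel = length (map inner (allFin m) ++ map leaf (allSpecies n Γ))

  leaf-ancestors : ∀ a {x} → x ∈ ancestors 𝒯 (leaf a) →
                   x ≡ leaf a ⊎ x ≡ root ⊎ ∃ λ f → HangsBelow a f × x ≡ inner f
  leaf-ancestors a x∈ with leaf-parent a
  ... | inj₁ (w , eq) with ancestor-step fuel eq x∈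
  ...   | inj₁ e   = inj₁ e
  ...   | inj₂ x∈′ = inj₂ (inj₁ (ancestor-orphan fuel refl x∈′))
  leaf-ancestors a x∈ | inj₂ (f , h , eq) with ancestor-step fuel eq x∈
  ...   | inj₁ e   = inj₁ e
  ...   | inj₂ x∈′ with inner-ancestors fuel f x∈′
  ...     | inj₁ e = inj₂ (inj₂ (f , h , e))
  ...     | inj₂ e = inj₂ (inj₁ e)

  leaf-above-leaf : ∀ {a b} → leaf b ∈ ancestors 𝒯 (leaf a) → b ≡ a
  leaf-above-leaf {a} b∈ with leaf-ancestors a b∈
  ... | inj₁ refl                 = refl
  ... | inj₂ (inj₁ ())
  ... | inj₂ (inj₂ (_ , _ , ()))

  inner-above-leaf : ∀ {a f} → inner f ∈ ancestors 𝒯 (leaf a) → HangsBelow a f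
  inner-above-leaf {a} f∈ with leaf-ancestors a f∈
  ... | inj₁ ()
  ... | inj₂ (inj₁ ())
  ... | inj₂ (inj₂ (_ , h , refl)) = h

  hangs⇒above : ∀ {a f} → HangsBelow a f → inner f ∈ ancestors 𝒯 (leaf a)
  hangs⇒above h = ancestor-parent fuel (hangs⇒parent h)

  -- The edge into node c belongs to the subtree spanned by A ∪ {root}.
  Spans : List (Species n Γ) → TNode n m Γ → Set
  Spans A c = Any (λ s → c ∈ ancestors 𝒯 s) (map leaf A)

  spans-leaf⇔ : ∀ {A s} → Spans A (leaf s) ⇔ s ∈ A
  spans-leaf⇔ = mk⇔ (λ sp → Any.map leaf-above-leaf (Any.map⁻ sp))
                    (λ s∈ → Any.map⁺ (Any.map (λ { refl → ancestor-refl (suc fuel) _ }) s∈))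

  spans-inner⇔ : ∀ {A f} → Spans A (inner f) ⇔ (∃ λ a → a ∈ A × HangsBelow a f)
  spans-inner⇔ = mk⇔ (λ sp → let a , a∈ , f∈ = find (Any.map⁻ sp) in a , a∈ , inner-above-leaf f∈)
                     (λ { (a , a∈ , h) → Any.map⁺ (lose a∈ (hangs⇒above h)) })

  hitEdges : List (Species n Γ) → ℕ
  hitEdges A = ∑ (λ f → χ (spans? 𝒯 (map leaf A) (inner f))) (allFin m)

  spanned-leaf : ∀ A s → χ (spans? 𝒯 (map leaf A) (leaf s)) ≡ χ (s ∈S? A)
  spanned-leaf A s = χ-cong (Equivalence.to spans-leaf⇔) (Equivalence.from spans-leaf⇔) (spans? 𝒯 (map leaf A) (leaf s)) (s ∈S? A)

  plain-contribution : ∀ A v i →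
    edgeContribution 𝒯 (map leaf A) (leaf (plain v i)) ≡ χ (plain v i ∈S? A)
  plain-contribution A v i with toℕ i <? degree G v
  ... | yes _ = spanned-leaf A (plain v i)
  ... | no _  = spanned-leaf A (plain v i)

  primed-contribution : ∀ A v i → edgeContribution 𝒯 (map leaf A) (leaf (primed v i)) ≡ 0
  primed-contribution A v i with does (spans? 𝒯 (map leaf A) (leaf (primed v i)))
  ... | true  = refl
  ... | false = refl

  PD-decomposition : ∀ A → PDC G Γ O A ≡ hitEdges A + plainCount A
  PD-decomposition A = begin
    PDC G Γ O A
      ≡⟨ ∑-++ ec (map inner (allFin m)) (map leaf (allSpecies n Γ)) ⟩
    ∑ ec (map inner (allFin m)) + ∑ ec (map leaf (allSpecies n Γ))
      ≡⟨ cong₂ _+_ (∑-map ec inner (allFin m)) (∑-map ec leaf (allSpecies n Γ)) ⟩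
    hitEdges A + ∑ (λ s → ec (leaf s)) (allSpecies n Γ)
      ≡⟨ cong (hitEdges A +_) (∑-speciesOf (λ s → ec (leaf s)) (allFin n)) ⟩
    hitEdges A + ∑ (λ v → ∑ (λ i → ec (leaf (plain v i)) + ec (leaf (primed v i))) (allFin Γ)) (allFin n)
      ≡⟨ cong (hitEdges A +_) (∑-cong (λ v → ∑-cong pendant (allFin Γ)) (allFin n)) ⟩
    hitEdges A + plainCount A ∎
    where
    open ≡-Reasoning
    ec = edgeContribution 𝒯 (map leaf A)
    pendant : ∀ {v} i → ec (leaf (plain v i)) + ec (leaf (primed v i)) ≡ χ (plain v i ∈S? A)
    pendant {v} i = trans (cong₂ _+_ (plain-contribution A v i) (primed-contribution A v i)) (+-identityʳ _)

  speciesOf-viable : ∀ S → Viable FoodWeb (speciesOf S)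
  speciesOf-viable S (plain v i) s∈ =
    inj₂ (primed v (proj₁ (top i)) , ∈-speciesOf⁺ S (∈-speciesOf⁻ S s∈) , toTop v i _ (proj₂ (top i)))
  speciesOf-viable S (primed v i) s∈ with predecessor i
  ... | inj₁ i≡0       = inj₁ λ { _ (down _ _ j i≡1+j) → 0≢1+n (trans (sym i≡0) i≡1+j) }
  ... | inj₂ (j , i≡1+j) = inj₂ (primed v j , ∈-speciesOf⁺ S (∈-speciesOf⁻ S s∈) , down v i j i≡1+j)

  module Viability {A : List (Species n Γ)} (viable : Viable FoodWeb A) where

    -- v_i feeds only on v'_Γ, and v'_{i+1} only on v'_i.
    plain⇒top : ∀ {v i} → plain v i ∈ A → ∃ λ j → suc (toℕ j) ≡ Γ × primed v j ∈ A
    plain⇒top {v} {i} s∈ with viable (plain v i) s∈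
    ... | inj₁ sink                              = ⊥-elim (sink _ (toTop v i _ (proj₂ (top i))))
    ... | inj₂ (_ , t∈ , toTop _ _ j j-top) = j , j-top , t∈

    primed-step : ∀ {v i j} → primed v i ∈ A → toℕ i ≡ suc (toℕ j) → primed v j ∈ A
    primed-step {v} {i} {j} s∈ i≡1+j with viable (primed v i) s∈
    ... | inj₁ sink                            = ⊥-elim (sink _ (down v i j i≡1+j))
    ... | inj₂ (_ , t∈ , down _ _ j′ i≡1+j′) =
          subst (λ j″ → primed v j″ ∈ A) (toℕ-injective (suc-injective (trans (sym i≡1+j′) i≡1+j))) t∈

    primed-below : ∀ d {v i j} → toℕ i + d ≡ toℕ j → primed v j ∈ A → primed v i ∈ A
    primed-below zero {v} {i} i+0≡j s∈ =
      subst (λ i′ → primed v i′ ∈ A) (toℕ-injective (trans (sym i+0≡j) (+-identityʳ _))) s∈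
    primed-below (suc d) {v} {i} {j} i+d≡j s∈ with predecessor j
    ... | inj₁ j≡0 = ⊥-elim (0≢1+n (trans (sym j≡0) (trans (sym i+d≡j) (+-suc (toℕ i) d))))
    ... | inj₂ (j′ , j≡1+j′) = primed-below d (suc-injective (trans (sym (+-suc (toℕ i) d)) (trans i+d≡j j≡1+j′)))
                                            (primed-step s∈ j≡1+j′)

    plain⇒saturated : ∀ {v i} → plain v i ∈ A → ∀ j → primed v j ∈ A
    plain⇒saturated s∈ j with plain⇒top s∈
    ... | j-top , j-top≡ , t∈ = primed-below (toℕ j-top ∸ toℕ j) (m+[n∸m]≡n j≤j-top) t∈
      where
      j≤j-top : toℕ j ≤ toℕ j-top
      j≤j-top = s≤s⁻¹ (subst (suc (toℕ j) ≤_) (sym j-top≡) (toℕ<n j))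

  open DecMembership (Data.Fin._≟_ {n}) using () renaming (_∈?_ to _∈V?_)

  -- From here on Γ bounds the degrees (the first half of IsMaxDegree).
  module _ (maxdeg : ∀ v → degree G v ≤ Γ) where
    open Covering.BoundedDegree G maxdeg

    incident⇒hangs : ∀ {v f} → Incident G f v → ∃ λ i → HangsBelow (plain v i) f
    incident⇒hangs {v} {f} inc with ord-surj v f inc
    ... | i , refl = inject≤ i (maxdeg v) , subst (HangsBelow _) same-edge (hangs v _ q)
      where
      q : toℕ (inject≤ i (maxdeg v)) < degree G v
      q = subst (_< degree G v) (sym (toℕ-inject≤ i (maxdeg v))) (toℕ<n i)
      same-edge : ord v (fromℕ< q) ≡ ord v i
      same-edge = cong (ord v) (toℕ-injective (trans (toℕ-fromℕ< q) (toℕ-inject≤ i (maxdeg v))))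

    covered≤hit : ∀ S → coveredEdges G S ≤ hitEdges (speciesOf S)
    covered≤hit S = begin
      coveredEdges G S                          ≡⟨ covered≡∑χ S ⟩
      ∑ (λ f → χ (covers? G S f)) (allFin m)    ≤⟨ ∑-mono (λ f → χ-mono hit (covers? G S f) (spans? 𝒯 _ (inner f))) (allFin m) ⟩
      hitEdges (speciesOf S)                    ∎
      where
      open ≤-Reasoning
      hit : ∀ {f} → Any (Incident G f) S → Spans (speciesOf S) (inner f)
      hit c with find c
      ... | v , v∈S , inc with incident⇒hangs inc
      ...   | i , h = Equivalence.from spans-inner⇔ (plain v i , ∈-speciesOf⁺ S v∈S , h)

    plainCount-speciesOf : ∀ {S} → Unique S → length S * Γ ≤ plainCount (speciesOf S)
    plainCount-speciesOf {S} uS = begin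
      length S * Γ                              ≤⟨ *-monoˡ-≤ Γ (unique-⊆⇒length≤ uS (λ v∈ → ∈-filter⁺ (_∈V? S) (∈-allFin _) v∈)) ⟩
      length (filter (_∈V? S) (allFin n)) * Γ   ≡⟨ sym (∑-χ*ʳ (_∈V? S) Γ) ⟩
      ∑ (λ v → χ (v ∈V? S) * Γ) (allFin n)      ≤⟨ ∑-mono per-vertex (allFin n) ⟩
      plainCount (speciesOf S)                  ∎
      where
      open ≤-Reasoning
      per-vertex : ∀ v → χ (v ∈V? S) * Γ ≤ ∑ (λ i → χ (plain v i ∈S? speciesOf S)) (allFin Γ)
      per-vertex v = χ*-lower (v ∈V? S) λ v∈S →
        ∑-allFin-≥ (λ i → ≤-reflexive (sym (χ-yes (plain v i ∈S? _) (∈-speciesOf⁺ S v∈S))))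

    cover⇒viableSet : ∀ {k W} →
      (∃ λ (S : List (Fin n)) → Unique S × length S ≡ k × W ≤ coveredEdges G S) →
      (∃ λ (A : List (Species n Γ)) →
         Unique A × length A ≡ 2 * k * Γ × Viable FoodWeb A × W + k * Γ ≤ PDC G Γ O A)
    cover⇒viableSet (S , uS , refl , W≤cov) =
      speciesOf S , speciesOf-unique uS , size , speciesOf-viable S ,
      ≤-trans (+-mono-≤ (≤-trans W≤cov (covered≤hit S)) (plainCount-speciesOf uS))
              (≤-reflexive (sym (PD-decomposition (speciesOf S))))
      where
      size : length (speciesOf S) ≡ 2 * length S * Γ
      size = trans (length-speciesOf S) (trans (sym (*-assoc (length S) 2 Γ)) (cong (_* Γ) (*-comm (length S) 2)))

    module Saturation {A : List (Species n Γ)} (viable : Viable FoodWeb A) where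
      open Viability viable

      Saturated : Fin n → Set
      Saturated v = ∀ i → primed v i ∈ A

      saturated? : ∀ v → Dec (Saturated v)
      saturated? v = all? (λ i → primed v i ∈S? A)

      saturated unsaturated : List (Fin n)
      saturated   = filter saturated? (allFin n)
      unsaturated = filter (λ v → ¬? (saturated? v)) (allFin n)

      -- Plain species occur only at saturated vertices …
      plainCount≤ : plainCount A ≤ length saturated * Γ
      plainCount≤ = begin
        plainCount A                                 ≤⟨ ∑-mono per-vertex (allFin n) ⟩
        ∑ (λ v → χ (saturated? v) * Γ) (allFin n)    ≡⟨ ∑-χ*ʳ saturated? Γ ⟩
        length saturated * Γ                         ∎
        where
        open ≤-Reasoning
        per-vertex : ∀ v → ∑ (λ i → χ (plain v i ∈S? A)) (allFin Γ) ≤ χ (saturated? v) * Γ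
        per-vertex v = χ*-upper (saturated? v) (λ _ → ∑-allFin-≤ (λ i → χ≤1 (plain v i ∈S? A)))
          (λ unsat → ∑-zero (λ i → χ-no (plain v i ∈S? A) (λ s∈ → unsat (plain⇒saturated s∈))) (allFin Γ))

      ≤primedCount : length saturated * Γ ≤ primedCount A
      ≤primedCount = begin
        length saturated * Γ                         ≡⟨ sym (∑-χ*ʳ saturated? Γ) ⟩
        ∑ (λ v → χ (saturated? v) * Γ) (allFin n)    ≤⟨ ∑-mono per-vertex (allFin n) ⟩
        primedCount A                                ∎
        where
        open ≤-Reasoning
        per-vertex : ∀ v → χ (saturated? v) * Γ ≤ ∑ (λ i → χ (primed v i ∈S? A)) (allFin Γ)
        per-vertex v = χ*-lower (saturated? v) λ sat →
          ∑-allFin-≥ (λ i → ≤-reflexive (sym (χ-yes (primed v i ∈S? A) (sat i))))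

      hit≤covered : hitEdges A ≤ coveredEdges G saturated
      hit≤covered = begin
        hitEdges A                                        ≤⟨ ∑-mono (λ f → χ-mono covering (spans? 𝒯 _ (inner f)) (covers? G saturated f)) (allFin m) ⟩
        ∑ (λ f → χ (covers? G saturated f)) (allFin m)    ≡⟨ sym (covered≡∑χ saturated) ⟩
        coveredEdges G saturated                          ∎
        where
        open ≤-Reasoning
        covering : ∀ {f} → Spans A (inner f) → Any (Incident G f) saturated
        covering sp with Equivalence.to spans-inner⇔ sp
        ... | _ , a∈ , hangs v i q =
          lose (∈-filter⁺ saturated? (∈-allFin v) (plain⇒saturated a∈)) (hangs⇒incident (hangs v i q))

      chosen : ℕ → List (Fin n)
      chosen k = take k (saturated ++ unsaturated)

      chosen-unique : ∀ k → Unique (chosen k)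
      chosen-unique k = Unique.take⁺ k (Unique.++⁺ (Unique.filter⁺ saturated? (Unique.allFin⁺ n))
                                                   (Unique.filter⁺ _ (Unique.allFin⁺ n)) disjoint)
        where
        disjoint : ∀ {v} → ¬ (v ∈ saturated × v ∈ unsaturated)
        disjoint (v∈sat , v∈unsat) = proj₂ (∈-filter⁻ _ {xs = allFin n} v∈unsat) (proj₂ (∈-filter⁻ saturated? {xs = allFin n} v∈sat))

      chosen-length : ∀ {k} → k ≤ n → length (chosen k) ≡ k
      chosen-length {k} k≤n = begin
        length (chosen k)                        ≡⟨ length-take k (saturated ++ unsaturated) ⟩
        k ⊓ length (saturated ++ unsaturated)    ≡⟨ cong (k ⊓_) (length-++ saturated) ⟩
        k ⊓ (length saturated + length unsaturated) ≡⟨ cong (k ⊓_) (length-filter-partition saturated? (allFin n)) ⟩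
        k ⊓ length (allFin n)                    ≡⟨ cong (k ⊓_) (length-allFin n) ⟩
        k ⊓ n                                    ≡⟨ m≤n⇒m⊓n≡m k≤n ⟩
        k                                        ∎
        where open ≡-Reasoning

    viableSet⇒cover : ∀ {k W} → k ≤ n →
      (∃ λ (A : List (Species n Γ)) →
         Unique A × length A ≡ 2 * k * Γ × Viable FoodWeb A × W + k * Γ ≤ PDC G Γ O A) →
      (∃ λ (S : List (Fin n)) → Unique S × length S ≡ k × W ≤ coveredEdges G S)
    viableSet⇒cover {k} {W} k≤n (A , _ , |A|≡ , viable , W+kΓ≤PD) =
      chosen k , chosen-unique k , chosen-length k≤n , W≤covered
      where
      open Saturation viable
      t P : ℕ
      t = length saturated
      P = plainCount A
      -- Dropping the saturated vertices beyond the first k loses (t ∸ k)Γ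
      -- edges, which the plain species leave room for.
      surplus : (t ∸ k) * Γ + P ≤ k * Γ
      surplus = subst (λ x → x + P ≤ k * Γ) (sym (*-distribʳ-∸ Γ t k)) (excess-bound plainCount≤ (begin
        P + t * Γ              ≤⟨ +-monoʳ-≤ P ≤primedCount ⟩
        P + primedCount A      ≤⟨ plain+primed≤length A ⟩
        length A               ≡⟨ |A|≡ ⟩
        2 * k * Γ              ≡⟨ *-assoc 2 k Γ ⟩
        k * Γ + (k * Γ + 0)    ≡⟨ cong (k * Γ +_) (+-identityʳ (k * Γ)) ⟩
        k * Γ + k * Γ          ∎))
        where open ≤-Reasoning
      W≤covered : W ≤ coveredEdges G (chosen k)
      W≤covered = +-cancelʳ-≤ (k * Γ) W _ (begin
        W + k * Γ                                        ≤⟨ W+kΓ≤PD ⟩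
        PDC G Γ O A                                      ≡⟨ PD-decomposition A ⟩
        hitEdges A + P                                   ≤⟨ +-monoˡ-≤ P (≤-trans hit≤covered (covered-take k saturated unsaturated)) ⟩
        coveredEdges G (chosen k) + (t ∸ k) * Γ + P      ≡⟨ +-assoc (coveredEdges G (chosen k)) _ P ⟩
        coveredEdges G (chosen k) + ((t ∸ k) * Γ + P)    ≤⟨ +-monoʳ-≤ (coveredEdges G (chosen k)) surplus ⟩
        coveredEdges G (chosen k) + k * Γ                ∎)
        where open ≤-Reasoning

lemma7 : ∀ {n m : ℕ} (G : Graph n m) (Γ : ℕ) → IsMaxDegree G Γ →
         (O : IncidenceOrdering G) (k W : ℕ) → k ≤ n →
         (∃ λ (S : List (Fin n)) →
             Unique S × length S ≡ k × W ≤ coveredEdges G S)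
         ⇔
         (∃ λ (A : List (Species n Γ)) →
             Unique A × length A ≡ 2 * k * Γ × Viable FoodWeb A
             × W + k * Γ ≤ PDC G Γ O A)
lemma7 G Γ (maxdeg , _) O k W k≤n = mk⇔ (cover⇒viableSet maxdeg) (viableSet⇒cover maxdeg k≤n)
  where open Construction G Γ O
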